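{- Let $P$ be a logic program, let $\Pi = P^\chi \cup P_g$, and let $M\in AS(\Pi)$. Then, $AS(\Pi\cup \Pi_M)\neq\emptyset$ if, and only if, $M$ is not a paracoherent answer set of $P$.
   Context: Let $P$ be a disjunctive logic program over a propositional signature $\Sigma$, with rules of the form $a_1\vee\cdots\vee a_l \leftarrow b_1,\ldots,b_m,\mathop{not}\, b_{m+1},\ldots,\mathop{not}\, b_n$; $AS(\cdot)$ denotes the set of answer sets. Let $\Sigma^\kappa=\Sigma\cup\{Ka\mid a\in\Sigma\}$. The epistemic $\kappa$-transformation $P^\kappa$ is obtained from $P$ by replacing each rule $r$ with nonempty negative body by the rules $\lambda_{r,1}\vee\cdots\vee\lambda_{r,l}\vee Kb_{m+1}\vee\cdots\vee Kb_n\leftarrow b_1,\ldots,b_m$; $a_i\leftarrow\lambda_{r,i}$; $\leftarrow\lambda_{r,i},b_j$; $\lambda_{r,i}\leftarrow a_i,\lambda_{r,k}$, for $1\le i,k\le l$, $m+1\le j\le n$, with fresh atoms $\lambda_{r,i}$. The epistemic HT-transformation $P^{HT}$ is $P^\kappa$ together with $Ka\leftarrow a$ for every $a\in\Sigma$ and $Ka_1\vee\cdots\vee Ka_l\vee Kb_{m+1}\vee\cdots\vee Kb_n\leftarrow Kb_1,\ldots,Kb_m$ for every rule of $P$. The gap of an interpretation $I$ is $\mathcal{G}(I)=\{Ka\in I\mid a\notin I\}$. Semi-stable models of $P$ are the sets $S\cap\Sigma^\kappa$ where $S$ is an answer set of $P^\kappa$ such that no answer set $J$ of $P^\kappa$ has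 $\mathcal{G}(J)\subset\mathcal{G}(S)$; semi-equilibrium models are defined in the same way using $P^{HT}$. A paracoherent answer set is a semi-stable model (when $\chi=\kappa$) or a semi-equilibrium model (when $\chi=HT$). Let $P^\chi$ be $P^\kappa$ or $P^{HT}$, let $P_g=\{gap(Ka)\leftarrow Ka,\ \mathop{not}\, a \mid a\in At(P)\}$, and let $\Pi=P^\chi\cup P_g$. For a set $I$ of atoms, $gap(I)=\{gap(Ka)\mid gap(Ka)\in I\}$. For a model $M$ of $\Pi$, $\Pi_M$ is the set of constraints consisting of $\leftarrow gap(M)$ (a constraint whose body contains all atoms in $gap(M)$) and $\leftarrow gap(Ka)$ for every atom $gap(Ka)\in At(\Pi)\setminus M$. -}

module Defs where

open import Data.Nat using (ℕ; zero; suc)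
open import Data.Bool using (Bool; true; false)
open import Data.List using (List; []; _∷_; _++_; map; concatMap; [_])
open import Data.List.Membership.Propositional using (_∈_)
open import Data.List.Relation.Unary.All using (All)
open import Data.List.Relation.Unary.Any using (Any)
open import Data.Product using (Σ; _×_; _,_; proj₁)
open import Relation.Binary.PropositionalEquality using (_≡_)
open import Relation.Nullary using (¬_)

-- Disjunctive logic programs over an atom type A
--   a₁ ∨ … ∨ aₗ ← b₁,…,bₘ, not bₘ₊₁,…, not bₙ

record Rule (A : Set) : Set where
  constructor rule
  field
    head : List A
    pos  : List A
    neg  : List A
open Rule public

Program : Set → Set
Program A = List (Rule A)

Interp : Set → Set
Interp A = A → Bool

-- rule r of the Gelfond–Lifschitz reduct P^I is satisfied by J
-- (if some negated atom is in I, the rule is deleted from the reduct)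
SatRed : {A : Set} → Interp A → Interp A → Rule A → Set
SatRed I J r =
  All (λ b → I b ≡ false) (neg r) →
  All (λ b → J b ≡ true) (pos r) →
  Any (λ a → J a ≡ true) (head r)

ModelRed : {A : Set} → Program A → Interp A → Interp A → Set
ModelRed P I J = All (SatRed I J) P

_⊂_ : {A : Set} → Interp A → Interp A → Set
J ⊂ I = (∀ a → J a ≡ true → I a ≡ true) × Σ _ (λ a → I a ≡ true × J a ≡ false)

AnswerSet : {A : Set} → Program A → Interp A → Set
AnswerSet P I = ModelRed P I I × ¬ (Σ (Interp _) (λ J → J ⊂ I × ModelRed P I J))

atoms : {A : Set} → Program A → List A
atoms P = concatMap (λ r → head r ++ pos r ++ neg r) P

-- Atoms of the transformed programs: the original signature Σ (ℕ),
-- the atoms Ka, the fresh atoms λ_{r,i} and the atoms gap(Ka).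

data Atom : Set where
  base : ℕ → Atom
  K    : ℕ → Atom
  lam  : ℕ → ℕ → Atom      -- λ_{r,i}  (r = index of the rule in P, i = head position)
  gap  : ℕ → Atom

indexed : {A : Set} → ℕ → List A → List (ℕ × A)
indexed n [] = []
indexed n (x ∷ xs) = (n , x) ∷ indexed (suc n) xs

mapRule : {A B : Set} → (A → B) → Rule A → Rule B
mapRule f (rule h p n) = rule (map f h) (map f p) (map f n)

kappaRule : ℕ → Rule ℕ → Program Atom
kappaRule k (rule h p []) = [ mapRule base (rule h p []) ]
kappaRule k (rule h p (b ∷ bs)) =
    rule (map (λ ia → lam k (proj₁ ia)) ih ++ map K ns) (map base p) []
  ∷ map (λ ia → rule [ base (Data.Product.proj₂ ia) ] [ lam k (proj₁ ia) ] []) ih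
  ++ concatMap (λ ia → map (λ c → rule [] (lam k (proj₁ ia) ∷ base c ∷ []) []) ns) ih
  ++ concatMap (λ ia → map (λ jb → rule [ lam k (proj₁ ia) ]
                                        (base (Data.Product.proj₂ ia) ∷ lam k (proj₁ jb) ∷ []) []) ih) ih
  where
    ih = indexed 0 h
    ns = b ∷ bs

kappaAux : ℕ → Program ℕ → Program Atom
kappaAux k [] = []
kappaAux k (r ∷ rs) = kappaRule k r ++ kappaAux (suc k) rs

kappa : Program ℕ → Program Atom
kappa P = kappaAux 0 P

HTtrans : List ℕ → Program ℕ → Program Atom
HTtrans Sig P =
  kappa P
  ++ map (λ a → rule [ K a ] [ base a ] []) Sig
  ++ map (λ r → rule (map K (head r) ++ map K (neg r)) (map K (pos r)) []) P

data Chi : Set where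
  κ  : Chi
  HT : Chi

transf : Chi → List ℕ → Program ℕ → Program Atom
transf κ  Sig P = kappa P
transf HT Sig P = HTtrans Sig P

Pg : Program ℕ → Program Atom
Pg P = map (λ a → rule [ gap a ] [ K a ] [ base a ]) (atoms P)

PiProg : Chi → List ℕ → Program ℕ → Program Atom
PiProg χ Sig P = transf χ Sig P ++ Pg P

gapIn : Interp Atom → List ℕ → List Atom
gapIn M [] = []
gapIn M (a ∷ as) with M (gap a)
... | true  = gap a ∷ gapIn M as
... | false = gapIn M as

gapOut : Interp Atom → List ℕ → Program Atom
gapOut M [] = []
gapOut M (a ∷ as) with M (gap a)
... | true  = gapOut M as
... | false = rule [] [ gap a ] [] ∷ gapOut M as

-- Π_M  (the gap atoms of Π are exactly gap(Ka) for a ∈ At(P))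
PiM : Program ℕ → Interp Atom → Program Atom
PiM P M = rule [] (gapIn M (atoms P)) [] ∷ gapOut M (atoms P)

InGap : Interp Atom → ℕ → Set
InGap I a = (I (K a) ≡ true) × (I (base a) ≡ false)

GapSub : Interp Atom → Interp Atom → Set
GapSub J S = (∀ a → InGap J a → InGap S a) × Σ ℕ (λ a → InGap S a × ¬ InGap J a)

-- X (an interpretation, considered on Σ^κ) is a paracoherent answer set of P:
-- X = S ∩ Σ^κ for some S ∈ AS(P^χ) with no J ∈ AS(P^χ) such that 𝒢(J) ⊂ 𝒢(S)
Paracoherent : Chi → List ℕ → Program ℕ → Interp Atom → Set
Paracoherent χ Sig P X =
  Σ (Interp Atom) (λ S →
      AnswerSet (transf χ Sig P) S
    × (∀ a → a ∈ Sig → (S (base a) ≡ X (base a)) × (S (K a) ≡ X (K a)))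
    × ¬ (Σ (Interp Atom) (λ J → AnswerSet (transf χ Sig P) J × GapSub J S)))

module Submission where

-- Write T = P^χ, Π = T ∪ P_g and L = At(P).  The proof rests on three facts.
--
--  * The gap atoms gap(Ka) occur in Π only in the heads of P_g, so answer sets
--    of Π and of T correspond: erasing the gap atoms maps AS(Π) into AS(T), and
--    adding gap(Ka) for every a ∈ L with Ka true and a false maps AS(T) back.
--  * In an answer set N of Π, gap(Ka) holds exactly when a ∈ L and a ∈ 𝒢(N);
--    moreover 𝒢(N) ⊆ L, because every rule of T deriving Ka has a ∈ L or has a
--    in its positive body.  Hence the constraints Π_M, which say that the gap
--    atoms of N form a proper subset of those of M, express 𝒢(N) ⊂ 𝒢(M).
--  * Existence of an answer set is decidable, since answer sets only contain
--    head atoms of the program and can therefore be searched for exhaustively.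
--
-- So an answer set of Π ∪ Π_M refutes that M is paracoherent, and if Π ∪ Π_M
-- has no answer set then M itself witnesses paracoherence; decidability turns
-- the latter into the constructive converse.

open import Defs
open import Data.Nat using (ℕ)
import Data.Nat as ℕ
open import Data.Bool using (Bool; true; false; if_then_else_)
import Data.Bool as Bool
open import Data.Bool.Properties using (¬-not)
open import Data.List using (List; []; _∷_; _++_; map; concatMap; [_])
open import Data.List.Membership.Propositional using (_∈_; lose; find)
open import Data.List.Membership.Propositional.Properties
  using (∈-map⁺; ∈-map⁻; ∈-++⁺ˡ; ∈-++⁺ʳ; ∈-++⁻; ∈-concatMap⁺)
open import Data.List.Relation.Unary.All using (All; []; _∷_; all?; tabulate)
import Data.List.Relation.Unary.All as All
open import Data.List.Relation.Unary.All.Properties using (++⁺; ++⁻ˡ; ++⁻ʳ; map⁺; concat⁺)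
open import Data.List.Relation.Unary.Any using (Any; here; there; any?; satisfied)
import Data.List.Relation.Unary.Any as Any
open import Data.Product using (Σ; _×_; _,_; proj₁; proj₂)
import Data.Product.Properties as Product
open import Data.Sum using (_⊎_; inj₁; inj₂)
import Data.Sum.Properties as Sum
open import Data.Empty using (⊥; ⊥-elim)
open import Data.Unit using (⊤; tt)
open import Function using (_∘_; case_of_)
open import Function.Bundles using (_⇔_; mk⇔)
open import Relation.Nullary using (¬_; Dec; yes; no; does)
open import Relation.Nullary.Decidable
  using (_×-dec_; _⊎-dec_; _→-dec_; ¬?; map′; dec-true; decidable-stable)
open import Relation.Binary.PropositionalEquality using (_≡_; _≢_; refl; sym; trans; cong)
open import Relation.Binary.Definitions using (DecidableEquality)

clash : ∀ {b} → b ≡ true → b ≡ false → ⊥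
clash refl ()

anyWithAll : {A : Set} {P Q R : A → Set} {xs : List A} →
  (∀ {x} → P x → Q x → R x) → All P xs → Any Q xs → Any R xs
anyWithAll f (p ∷ _)  (here q)  = here (f p q)
anyWithAll f (_ ∷ ps) (there q) = there (anyWithAll f ps q)

-- General facts on answer sets, for an arbitrary type of atoms

module _ {A : Set} where

  _≐_ : Interp A → Interp A → Set
  J ≐ J' = ∀ y → J y ≡ J' y

  satRed-cong : ∀ {I I' J J' : Interp A} r → I ≐ I' → J ≐ J' → SatRed I J r → SatRed I' J' r
  satRed-cong r I≐I' J≐J' sat negs poss =
    Any.map (λ {x} e → trans (sym (J≐J' x)) e)
      (sat (All.map (λ {x} e → trans (I≐I' x) e) negs) (All.map (λ {x} e → trans (J≐J' x) e) poss))

  modelRed-cong : ∀ {I I' J J' : Interp A} (Q : Program A) → I ≐ I' → J ≐ J' →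
    ModelRed Q I J → ModelRed Q I' J'
  modelRed-cong Q I≐I' J≐J' = All.map (λ {r} → satRed-cong r I≐I' J≐J')

  ⊂-respˡ : ∀ {J J' N : Interp A} → J ≐ J' → J ⊂ N → J' ⊂ N
  ⊂-respˡ J≐J' (sub , (w , Nw , Jw)) = (λ a e → sub a (trans (J≐J' a) e)) , (w , Nw , trans (sym (J≐J' w)) Jw)

  ⊂-respʳ : ∀ {J N N' : Interp A} → N ≐ N' → J ⊂ N → J ⊂ N'
  ⊂-respʳ N≐N' (sub , (w , Nw , Jw)) = (λ a e → trans (sym (N≐N' a)) (sub a e)) , (w , trans (sym (N≐N' w)) Nw , Jw)

  answerSet-resp : ∀ (Q : Program A) {N N' : Interp A} → N ≐ N' → AnswerSet Q N → AnswerSet Q N'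
  answerSet-resp Q N≐N' (model , minimal) =
    modelRed-cong Q N≐N' N≐N' model ,
    λ { (J , J⊂ , mJ) → minimal (J , ⊂-respʳ (sym ∘ N≐N') J⊂ , modelRed-cong Q (sym ∘ N≐N') (λ _ → refl) mJ) }

  positive-transfer : (U : A → Set) {r : Rule A} → neg r ≡ [] → All U (head r) → All U (pos r) →
    {I I' J J' : Interp A} → (∀ x → U x → J x ≡ J' x) → SatRed I J r → SatRed I' J' r
  positive-transfer U {rule h p .[]} refl Uh Up agree sat _ poss =
    anyWithAll (λ {x} Ux e → trans (sym (agree x Ux)) e) Uh
      (sat [] (All.zipWith (λ {x} (Ux , e) → trans (agree x Ux) e) (Up , poss)))

  Constraint : Rule A → Set
  Constraint r = (head r ≡ []) × (neg r ≡ [])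

  constraint-antitone : ∀ {I N J : Interp A} {r} → Constraint r → SatRed I N r →
    (∀ x → J x ≡ true → N x ≡ true) → SatRed I J r
  constraint-antitone {r = rule .[] p .[]} (refl , refl) sat J⊆N _ poss
    with () ← sat [] (All.map (λ {x} → J⊆N x) poss)

  answerSet-split : ∀ (Q C : Program A) {N} → All Constraint C → AnswerSet (Q ++ C) N →
    AnswerSet Q N × ModelRed C N N
  answerSet-split Q C constraints (model , minimal) =
    (++⁻ˡ Q model ,
     λ { (J , J⊂ , mJ) → minimal (J , J⊂ , ++⁺ mJ (tabulate λ r∈ →
          constraint-antitone (All.lookup constraints r∈) (All.lookup (++⁻ʳ Q model) r∈) (proj₁ J⊂))) }) ,
    ++⁻ʳ Q model

  answerSet-join : ∀ (Q C : Program A) {N} → AnswerSet Q N → ModelRed C N N → AnswerSet (Q ++ C) N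
  answerSet-join Q C (model , minimal) mC =
    ++⁺ model mC , λ { (J , J⊂ , mJ) → minimal (J , J⊂ , ++⁻ˡ Q mJ) }

-- Support and decidability, for atoms with decidable equality

module WithDecidableAtoms {A : Set} (_≟_ : DecidableEquality A) where

  open import Data.List.Membership.DecPropositional _≟_ using (_∈?_)

  _[_≔_] : Interp A → A → Bool → Interp A
  (J [ x ≔ b ]) y = if does (y ≟ x) then b else J y

  ≔-same : ∀ J x b → (J [ x ≔ b ]) x ≡ b
  ≔-same J x b with x ≟ x
  ... | yes _   = refl
  ... | no x≢x = ⊥-elim (x≢x refl)

  ≔-other : ∀ J {x y} b → y ≢ x → (J [ x ≔ b ]) y ≡ J y
  ≔-other J {x} {y} b y≢x with y ≟ x
  ... | yes y≡x = ⊥-elim (y≢x y≡x)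
  ... | no _    = refl

  ≔-false-below : ∀ J x y → (J [ x ≔ false ]) y ≡ true → J y ≡ true
  ≔-false-below J x y with y ≟ x
  ... | yes _ = λ ()
  ... | no _  = λ e → e

  ≔-cong : ∀ {J J'} x b → J ≐ J' → (J [ x ≔ b ]) ≐ (J' [ x ≔ b ])
  ≔-cong x b J≐J' y with y ≟ x
  ... | yes _ = refl
  ... | no _  = J≐J' y

  ≔-restore : ∀ J x b c → J x ≡ b → J ≐ ((J [ x ≔ c ]) [ x ≔ b ])
  ≔-restore J x b c Jx y with y ≟ x
  ... | yes refl = Jx
  ... | no _     = refl

  ≔-redundant : ∀ J x b → J x ≡ b → J ≐ (J [ x ≔ b ])
  ≔-redundant J x b Jx y with y ≟ x
  ... | yes refl = Jx
  ... | no _     = refl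

  Supports : Interp A → A → Rule A → Set
  Supports N x r =
    x ∈ head r × All (λ b → N b ≡ false) (neg r) × All (λ b → (N [ x ≔ false ]) b ≡ true) (pos r)

  supports? : ∀ (N : Interp A) x r → Dec (Supports N x r)
  supports? N x r = x ∈? head r
    ×-dec all? (λ b → N b Bool.≟ false) (neg r)
    ×-dec all? (λ b → (N [ x ≔ false ]) b Bool.≟ true) (pos r)

  -- every true atom of an answer set is supported by some rule; otherwise
  -- removing it would yield a smaller model of the reduct
  supported : ∀ {Q N x} → AnswerSet Q N → N x ≡ true → Any (Supports N x) Q
  supported {Q} {N} {x} (model , minimal) Nx with any? (supports? N x) Q
  ... | yes support = support
  ... | no unsupported = ⊥-elim (minimal (N [ x ≔ false ] , smaller , tabulate fires))
    where
      smaller : (N [ x ≔ false ]) ⊂ N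
      smaller = ≔-false-below N x , (x , Nx , ≔-same N x false)

      avoid : ∀ {hs} → Any (λ a → N a ≡ true) hs → ¬ x ∈ hs → Any (λ a → (N [ x ≔ false ]) a ≡ true) hs
      avoid (here Nh) x∉ = here (trans (≔-other N false (x∉ ∘ here ∘ sym)) Nh)
      avoid (there any) x∉ = there (avoid any (x∉ ∘ there))

      fires : ∀ {r} → r ∈ Q → SatRed N (N [ x ≔ false ]) r
      fires r∈ negs poss =
        avoid (All.lookup model r∈ negs (All.map (λ {b} → ≔-false-below N x b) poss))
              (λ x∈ → unsupported (lose r∈ (x∈ , negs , poss)))

  heads : Program A → List A
  heads = concatMap head

  Within : Interp A → List A → Set
  Within J xs = ∀ y → J y ≡ true → y ∈ xs

  answerSet-within-heads : ∀ {Q N} → AnswerSet Q N → Within N (heads Q)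
  answerSet-within-heads {Q} asN y Ny = ∈-concatMap⁺ head (Any.map proj₁ (supported asN Ny))

  ∅ : Interp A
  ∅ _ = false

  within-[] : ∀ {J} → Within J [] → J ≐ ∅
  within-[] {J} w y with J y in Jy
  ... | true  with () ← w y Jy
  ... | false = refl

  within-set : ∀ {J x xs} → Within J xs → Within (J [ x ≔ true ]) (x ∷ xs)
  within-set {x = x} w y with y ≟ x
  ... | yes y≡x = λ _ → here y≡x
  ... | no _    = there ∘ w y

  within-unset : ∀ {J x xs} → Within J (x ∷ xs) → Within (J [ x ≔ false ]) xs
  within-unset {x = x} w y with y ≟ x
  ... | yes _   = λ ()
  ... | no y≢x = λ Jy → case w y Jy of λ { (here y≡x) → ⊥-elim (y≢x y≡x) ; (there y∈) → y∈ }

  search : (xs : List A) (Q : Interp A → Set) → (∀ {J J'} → J ≐ J' → Q J → Q J') →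
    (∀ J → Within J xs → Dec (Q J)) → Dec (Σ (Interp A) (λ J → Within J xs × Q J))
  search [] Q resp Q? with Q? ∅ (λ _ ())
  ... | yes q  = yes (∅ , (λ _ ()) , q)
  ... | no ¬q = no λ { (J , w , q) → ¬q (resp (within-[] w) q) }
  search (x ∷ xs) Q resp Q?
    with search xs (λ J → Q J ⊎ Q (J [ x ≔ true ]))
           (λ { J≐J' (inj₁ q) → inj₁ (resp J≐J' q) ; J≐J' (inj₂ q) → inj₂ (resp (≔-cong x true J≐J') q) })
           (λ J w → Q? J (λ y → there ∘ w y) ⊎-dec Q? (J [ x ≔ true ]) (within-set w))
  ... | yes (J , w , inj₁ q) = yes (J , (λ y → there ∘ w y) , q)
  ... | yes (J , w , inj₂ q) = yes (J [ x ≔ true ] , within-set w , q)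
  ... | no none = no λ { (J , w , q) → none (J [ x ≔ false ] , within-unset w , splitOn J q) }
    where
      splitOn : ∀ J → Q J → Q (J [ x ≔ false ]) ⊎ Q ((J [ x ≔ false ]) [ x ≔ true ])
      splitOn J q with J x in Jx
      ... | true  = inj₂ (resp (≔-restore J x true false Jx) q)
      ... | false = inj₁ (resp (≔-redundant J x false Jx) q)

  satRed? : ∀ (I J : Interp A) r → Dec (SatRed I J r)
  satRed? I J r = all? (λ b → I b Bool.≟ false) (neg r)
    →-dec (all? (λ b → J b Bool.≟ true) (pos r) →-dec any? (λ a → J a Bool.≟ true) (head r))

  modelRed? : ∀ (Q : Program A) I J → Dec (ModelRed Q I J)
  modelRed? Q I J = all? (satRed? I J) Q

  ⊂? : ∀ {U} (J N : Interp A) → Within J U → Within N U → Dec (J ⊂ N)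
  ⊂? {U} J N wJ wN
    with all? (λ y → (J y Bool.≟ true) →-dec (N y Bool.≟ true)) U
       | any? (λ y → (N y Bool.≟ true) ×-dec (J y Bool.≟ false)) U
  ... | yes J⊆N | yes strict = yes ((λ y Jy → All.lookup J⊆N (wJ y Jy) Jy) , satisfied strict)
  ... | no J⊈N  | _          = no λ { (J⊆N , _) → J⊈N (tabulate λ {y} _ → J⊆N y) }
  ... | _        | no equal   = no λ { (_ , (w , Nw , Jw)) → equal (lose (wN w Nw) (Nw , Jw)) }

  answerSet? : ∀ (Q : Program A) {U} N → Within N U → Dec (AnswerSet Q N)
  answerSet? Q {U} N wN = modelRed? Q N N ×-dec ¬? smaller?
    where
      smaller? : Dec (Σ (Interp A) (λ J → J ⊂ N × ModelRed Q N J))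
      smaller? with search U (λ J → J ⊂ N × ModelRed Q N J)
                      (λ J≐J' (J⊂ , mJ) → ⊂-respˡ J≐J' J⊂ , modelRed-cong Q (λ _ → refl) J≐J' mJ)
                      (λ J wJ → ⊂? J N wJ wN ×-dec modelRed? Q N J)
      ... | yes (J , _ , J⊂ , mJ) = yes (J , J⊂ , mJ)
      ... | no none = no λ { (J , J⊂ , mJ) → none (J , (λ y → wN y ∘ proj₁ J⊂ y) , J⊂ , mJ) }

  existsAnswerSet? : ∀ (Q : Program A) → Dec (Σ (Interp A) (AnswerSet Q))
  existsAnswerSet? Q
    with search (heads Q) (AnswerSet Q) (answerSet-resp Q) (λ N → answerSet? Q N)
  ... | yes (N , _ , asN) = yes (N , asN)
  ... | no none = no λ { (N , asN) → none (N , answerSet-within-heads asN , asN) }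

-- Atom embeds into a sum of products of ℕ, which has decidable equality
private
  Code : Set
  Code = ℕ ⊎ ℕ ⊎ (ℕ × ℕ) ⊎ ℕ

  encode : Atom → Code
  encode (base a)  = inj₁ a
  encode (K a)     = inj₂ (inj₁ a)
  encode (lam k i) = inj₂ (inj₂ (inj₁ (k , i)))
  encode (gap a)   = inj₂ (inj₂ (inj₂ a))

  decode : Code → Atom
  decode (inj₁ a)                      = base a
  decode (inj₂ (inj₁ a))               = K a
  decode (inj₂ (inj₂ (inj₁ (k , i)))) = lam k i
  decode (inj₂ (inj₂ (inj₂ a)))        = gap a

  decode-encode : ∀ x → decode (encode x) ≡ x
  decode-encode (base _)  = refl
  decode-encode (K _)     = refl
  decode-encode (lam _ _) = refl
  decode-encode (gap _)   = refl

  _≟ᶜ_ : DecidableEquality Code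
  _≟ᶜ_ = Sum.≡-dec ℕ._≟_ (Sum.≡-dec ℕ._≟_ (Sum.≡-dec (Product.≡-dec ℕ._≟_ ℕ._≟_) ℕ._≟_))

_≟ᴬ_ : DecidableEquality Atom
x ≟ᴬ y = map′ encode-injective (cong encode) (encode x ≟ᶜ encode y)
  where
    encode-injective : encode x ≡ encode y → x ≡ y
    encode-injective e = trans (sym (decode-encode x)) (trans (cong decode e) (decode-encode y))

open WithDecidableAtoms _≟ᴬ_

NonGap : Atom → Set
NonGap (gap _) = ⊥
NonGap _       = ⊤

-- Shape of P^χ

HeadOk : List ℕ → List Atom → Atom → Set
HeadOk L p (K a)   = a ∈ L ⊎ base a ∈ p
HeadOk L p (gap _) = ⊥
HeadOk L p _       = ⊤

headOk-nonGap : ∀ {L p} x → HeadOk L p x → NonGap x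
headOk-nonGap (base _)  _ = tt
headOk-nonGap (K _)     _ = tt
headOk-nonGap (lam _ _) _ = tt

Admissible : List ℕ → Rule Atom → Set
Admissible L r = (neg r ≡ []) × All (HeadOk L (pos r)) (head r) × All NonGap (pos r)

admissible-transfer : ∀ {L r} → Admissible L r → {I I' J J' : Interp Atom} →
  (∀ x → NonGap x → J x ≡ J' x) → SatRed I J r → SatRed I' J' r
admissible-transfer (negFree , headsOk , posOk) =
  positive-transfer NonGap negFree (All.map (λ {x} → headOk-nonGap x) headsOk) posOk

private
  allMap : {A B : Set} {Q : B → Set} (f : A → B) (xs : List A) →
    (∀ {x} → x ∈ xs → Q (f x)) → All Q (map f xs)
  allMap f xs h = map⁺ (tabulate h)

  allConcatMap : {A B : Set} {Q : B → Set} (f : A → List B) (xs : List A) →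
    (∀ {x} → x ∈ xs → All Q (f x)) → All Q (concatMap f xs)
  allConcatMap f xs h = concat⁺ (allMap f xs h)

kappaRule-admissible : ∀ L k r → (∀ {b} → b ∈ neg r → b ∈ L) → All (Admissible L) (kappaRule k r)
kappaRule-admissible L k (rule h p []) _ =
  (refl , allMap base h (λ _ → tt) , allMap base p (λ _ → tt)) ∷ []
kappaRule-admissible L k (rule h p (b ∷ bs)) negs⊆L =
  (refl , ++⁺ (allMap _ (indexed 0 h) (λ _ → tt)) (allMap K (b ∷ bs) (inj₁ ∘ negs⊆L)) ,
          allMap base p (λ _ → tt))
  ∷ ++⁺ (allMap _ (indexed 0 h) (λ _ → refl , (tt ∷ []) , (tt ∷ [])))
    (++⁺ (allConcatMap _ (indexed 0 h) (λ _ → allMap _ (b ∷ bs) (λ _ → refl , [] , (tt ∷ tt ∷ []))))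
         (allConcatMap _ (indexed 0 h) (λ _ →
            allMap _ (indexed 0 h) (λ _ → refl , (tt ∷ []) , (tt ∷ tt ∷ [])))))

kappaAux-admissible : ∀ L k rs → (∀ {b} → b ∈ atoms rs → b ∈ L) → All (Admissible L) (kappaAux k rs)
kappaAux-admissible L k [] _ = []
kappaAux-admissible L k (r ∷ rs) atoms⊆L =
  ++⁺ (kappaRule-admissible L k r (atoms⊆L ∘ ∈-++⁺ˡ ∘ ∈-++⁺ʳ (head r) ∘ ∈-++⁺ʳ (pos r)))
      (kappaAux-admissible L (ℕ.suc k) rs (atoms⊆L ∘ ∈-++⁺ʳ (head r ++ pos r ++ neg r)))

atoms-rule : ∀ {r a} (P : Program ℕ) → r ∈ P → a ∈ head r ++ pos r ++ neg r → a ∈ atoms P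
atoms-rule (r ∷ P) (here refl) a∈ = ∈-++⁺ˡ a∈
atoms-rule (r ∷ P) (there r∈) a∈ = ∈-++⁺ʳ (head r ++ pos r ++ neg r) (atoms-rule P r∈ a∈)

-- P^χ is admissible; for P^HT the extra rules Ka ← a have a in the body
transf-admissible : ∀ χ Sig P → All (Admissible (atoms P)) (transf χ Sig P)
transf-admissible κ Sig P = kappaAux-admissible (atoms P) 0 P (λ a∈ → a∈)
transf-admissible HT Sig P =
  ++⁺ (kappaAux-admissible (atoms P) 0 P (λ a∈ → a∈))
   (++⁺ (allMap _ Sig (λ _ → refl , (inj₂ (here refl) ∷ []) , (tt ∷ [])))
        (allMap _ P (λ {r} r∈ → refl ,
           ++⁺ (allMap K (head r) (inj₁ ∘ atoms-rule P r∈ ∘ ∈-++⁺ˡ))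
               (allMap K (neg r) (inj₁ ∘ atoms-rule P r∈ ∘ ∈-++⁺ʳ (head r) ∘ ∈-++⁺ʳ (pos r))) ,
           allMap K (pos r) (λ _ → tt))))

-- Meaning of the constraints Π_M

GapAtomsBelow : List ℕ → Interp Atom → Interp Atom → Set
GapAtomsBelow as N M =
  (∀ a → a ∈ as → M (gap a) ≡ false → N (gap a) ≡ false)
  × Σ ℕ (λ a → a ∈ as × M (gap a) ≡ true × N (gap a) ≡ false)

gapIn-missing : ∀ (M N : Interp Atom) as → ¬ All (λ b → N b ≡ true) (gapIn M as) →
  Σ ℕ (λ a → a ∈ as × M (gap a) ≡ true × N (gap a) ≡ false)
gapIn-missing M N [] ¬all = ⊥-elim (¬all [])
gapIn-missing M N (a ∷ as) ¬all with M (gap a) in Ma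
... | false = let b , b∈ , Mb , Nb = gapIn-missing M N as ¬all in b , there b∈ , Mb , Nb
... | true with N (gap a) in Na
...   | false = a , here refl , Ma , Na
...   | true  = let b , b∈ , Mb , Nb = gapIn-missing M N as (¬all ∘ (Na ∷_)) in b , there b∈ , Mb , Nb

gapIn-all : ∀ (M N : Interp Atom) {a} as → a ∈ as → M (gap a) ≡ true →
  All (λ b → N b ≡ true) (gapIn M as) → N (gap a) ≡ true
gapIn-all M N (b ∷ as) a∈ Ma all with M (gap b) in Mb
gapIn-all M N (b ∷ as) (here refl) Ma all       | false = ⊥-elim (clash Ma Mb)
gapIn-all M N (b ∷ as) (there a∈) Ma all        | false = gapIn-all M N as a∈ Ma all
gapIn-all M N (b ∷ as) (here refl) Ma (Nb ∷ _)  | true  = Nb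
gapIn-all M N (b ∷ as) (there a∈) Ma (_ ∷ all)  | true  = gapIn-all M N as a∈ Ma all

gapOut-sound : ∀ (M I N : Interp Atom) {a} as → ModelRed (gapOut M as) I N → a ∈ as →
  M (gap a) ≡ false → N (gap a) ≡ false
gapOut-sound M I N (b ∷ as) sat a∈ Ma with M (gap b) in Mb
gapOut-sound M I N (b ∷ as) sat (here refl) Ma        | true  = ⊥-elim (clash Mb Ma)
gapOut-sound M I N (b ∷ as) sat (there a∈) Ma         | true  = gapOut-sound M I N as sat a∈ Ma
gapOut-sound M I N (b ∷ as) (_ ∷ sat) (there a∈) Ma   | false = gapOut-sound M I N as sat a∈ Ma
gapOut-sound M I N (b ∷ as) (c ∷ _) (here refl) Ma    | false =
  ¬-not (λ Nb → case c [] (Nb ∷ []) of λ ())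

gapOut-complete : ∀ (M I N : Interp Atom) as → (∀ a → a ∈ as → M (gap a) ≡ false → N (gap a) ≡ false) →
  ModelRed (gapOut M as) I N
gapOut-complete M I N [] _ = []
gapOut-complete M I N (b ∷ as) below with M (gap b) in Mb
... | true  = gapOut-complete M I N as (λ a → below a ∘ there)
... | false = (λ { _ (Nb ∷ []) → ⊥-elim (clash Nb (below b (here refl) Mb)) })
              ∷ gapOut-complete M I N as (λ a → below a ∘ there)

gapOut-constraints : ∀ (M : Interp Atom) as → All Constraint (gapOut M as)
gapOut-constraints M [] = []
gapOut-constraints M (b ∷ as) with M (gap b)
... | true  = gapOut-constraints M as
... | false = (refl , refl) ∷ gapOut-constraints M as

PiM-constraints : ∀ P M → All Constraint (PiM P M)
PiM-constraints P M = (refl , refl) ∷ gapOut-constraints M (atoms P)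

PiM-sound : ∀ P {M I N} → ModelRed (PiM P M) I N → GapAtomsBelow (atoms P) N M
PiM-sound P {M} {I} {N} (notAll ∷ outside) =
  (λ a a∈ → gapOut-sound M I N (atoms P) outside a∈) ,
  gapIn-missing M N (atoms P) (λ all → case notAll [] all of λ ())

PiM-complete : ∀ P {M I N} → GapAtomsBelow (atoms P) N M → ModelRed (PiM P M) I N
PiM-complete P {M} {I} {N} (below , (w , w∈ , Mw , Nw)) =
  (λ _ all → ⊥-elim (clash (gapIn-all M N (atoms P) w∈ Mw all) Nw))
  ∷ gapOut-complete M I N (atoms P) below

-- Answer sets of Π = P^χ ∪ P_g versus answer sets of P^χ

module Correspondence (Sig : List ℕ) (P : Program ℕ) (χ : Chi) where

  open import Data.List.Membership.DecPropositional ℕ._≟_ using (_∈?_)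

  L : List ℕ
  L = atoms P

  T : Program Atom
  T = transf χ Sig P

  Π : Program Atom
  Π = PiProg χ Sig P

  T-admissible : All (Admissible L) T
  T-admissible = transf-admissible χ Sig P

  gapRule : ℕ → Rule Atom
  gapRule a = rule [ gap a ] [ K a ] [ base a ]

  Π-rules : ∀ {r} → r ∈ Π → r ∈ T ⊎ Σ ℕ (λ a → a ∈ L × r ≡ gapRule a)
  Π-rules r∈ with ∈-++⁻ T r∈
  ... | inj₁ r∈T = inj₁ r∈T
  ... | inj₂ r∈Pg = inj₂ (∈-map⁻ gapRule r∈Pg)

  gapRule-fires : ∀ {I N a} → ModelRed Π I N → a ∈ L → N (K a) ≡ true → I (base a) ≡ false →
    N (gap a) ≡ true
  gapRule-fires model a∈ Ka ¬a with All.lookup model (∈-++⁺ʳ T (∈-map⁺ gapRule a∈)) (¬a ∷ []) (Ka ∷ [])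
  ... | here Ngap = Ngap

  T-no-gap-head : ∀ {r a} → r ∈ T → ¬ gap a ∈ head r
  T-no-gap-head r∈ = All.lookup (proj₁ (proj₂ (All.lookup T-admissible r∈)))

  gapAtom-inGap : ∀ {N a} → AnswerSet Π N → N (gap a) ≡ true → InGap N a
  gapAtom-inGap {N} {a} asN Ngap with find (supported asN Ngap)
  ... | r , r∈ , support with Π-rules r∈
  ...   | inj₁ r∈T = ⊥-elim (T-no-gap-head r∈T (proj₁ support))
  gapAtom-inGap {N} {a} asN Ngap | r , r∈ , (here refl , ¬a ∷ [] , Ka ∷ []) | inj₂ (.a , _ , refl) =
    ≔-false-below N (gap a) (K a) Ka , ¬a

  inGap-gapAtom : ∀ {N a} → ModelRed Π N N → a ∈ L → InGap N a → N (gap a) ≡ true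
  inGap-gapAtom model a∈ (Ka , ¬a) = gapRule-fires model a∈ Ka ¬a

  -- the gaps of an answer set of Π lie in L = At(P): the rules deriving Ka
  -- either have a ∈ L or require a itself
  gap-in-atoms : ∀ {N a} → AnswerSet Π N → InGap N a → a ∈ L
  gap-in-atoms {N} {a} asN (Ka , ¬a) with find (supported asN Ka)
  ... | r , r∈ , (Ka∈ , _ , poss) with Π-rules r∈
  ...   | inj₂ (_ , _ , refl) = case Ka∈ of λ { (here ()) ; (there ()) }
  ...   | inj₁ r∈T with All.lookup (proj₁ (proj₂ (All.lookup T-admissible r∈T))) Ka∈
  ...     | inj₁ a∈L = a∈L
  ...     | inj₂ a∈body = ⊥-elim (clash (≔-false-below N (K a) (base a) (All.lookup poss a∈body)) ¬a)

  erase : Interp Atom → Interp Atom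
  erase N (gap _) = false
  erase N x       = N x

  erase-nonGap : ∀ N x → NonGap x → N x ≡ erase N x
  erase-nonGap N (base _)  _ = refl
  erase-nonGap N (K _)     _ = refl
  erase-nonGap N (lam _ _) _ = refl

  overlay : Interp Atom → Interp Atom → Interp Atom
  overlay J N (gap a) = N (gap a)
  overlay J N x       = J x

  overlay-nonGap : ∀ J N x → NonGap x → J x ≡ overlay J N x
  overlay-nonGap J N (base _)  _ = refl
  overlay-nonGap J N (K _)     _ = refl
  overlay-nonGap J N (lam _ _) _ = refl

  -- erasing gap atoms maps AS(Π) into AS(T); a smaller model of T^{erase N}
  -- would give one of Π^N by keeping the gap atoms of N
  erase-answerSet : ∀ {N} → AnswerSet Π N → AnswerSet T (erase N)
  erase-answerSet {N} (model , minimal) =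
    tabulate (λ r∈ → admissible-transfer (All.lookup T-admissible r∈) (erase-nonGap N)
                       (All.lookup model (∈-++⁺ˡ r∈))) ,
    λ { (J , J⊂ , mJ) → minimal (overlay J N , overlay-below J⊂ , tabulate (overlay-model J⊂ mJ)) }
    where
      overlay-below : ∀ {J} → J ⊂ erase N → overlay J N ⊂ N
      overlay-below {J} (J⊆ , (w , Nw , Jw)) = below , strict w Nw Jw
        where
          below : ∀ x → overlay J N x ≡ true → N x ≡ true
          below (gap _)   e = e
          below (base a)  e = J⊆ (base a) e
          below (K a)     e = J⊆ (K a) e
          below (lam k i) e = J⊆ (lam k i) e
          strict : ∀ w → erase N w ≡ true → J w ≡ false → Σ Atom (λ w → N w ≡ true × overlay J N w ≡ false)
          strict (base a)  Nw Jw = base a , Nw , Jw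
          strict (K a)     Nw Jw = K a , Nw , Jw
          strict (lam k i) Nw Jw = lam k i , Nw , Jw
          strict (gap _)   ()

      overlay-model : ∀ {J} → J ⊂ erase N → ModelRed T (erase N) J →
        ∀ {r} → r ∈ Π → SatRed N (overlay J N) r
      overlay-model {J} J⊂ mJ r∈ with Π-rules r∈
      ... | inj₁ r∈T = admissible-transfer (All.lookup T-admissible r∈T) (overlay-nonGap J N)
                         (All.lookup mJ r∈T)
      ... | inj₂ (a , a∈ , refl) = λ { (¬a ∷ []) (Ka ∷ []) →
              here (gapRule-fires model a∈ (proj₁ J⊂ (K a) Ka) ¬a) }

  gap? : ∀ J a → Dec (a ∈ L × InGap J a)
  gap? J a = a ∈? L ×-dec (J (K a) Bool.≟ true ×-dec J (base a) Bool.≟ false)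

  withGaps : Interp Atom → Interp Atom
  withGaps J (gap a) = does (gap? J a)
  withGaps J x       = J x

  withGaps-nonGap : ∀ J x → NonGap x → J x ≡ withGaps J x
  withGaps-nonGap J (base _)  _ = refl
  withGaps-nonGap J (K _)     _ = refl
  withGaps-nonGap J (lam _ _) _ = refl

  withGaps-gap : ∀ J {a} → withGaps J (gap a) ≡ true → a ∈ L × InGap J a
  withGaps-gap J {a} = witness (gap? J a)
    where
      witness : ∀ {X : Set} (X? : Dec X) → does X? ≡ true → X
      witness (yes x) _ = x

  withGaps-answerSet : ∀ {J} → AnswerSet T J → AnswerSet Π (withGaps J)
  withGaps-answerSet {J} (model , minimal) =
    tabulate withGaps-model , λ { (J' , J'⊂ , mJ') → minimal (erase J' , erase-below J'⊂ mJ' , erase-model mJ') }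
    where
      withGaps-model : ∀ {r} → r ∈ Π → SatRed (withGaps J) (withGaps J) r
      withGaps-model r∈ with Π-rules r∈
      ... | inj₁ r∈T = admissible-transfer (All.lookup T-admissible r∈T) (withGaps-nonGap J)
                         (All.lookup model r∈T)
      ... | inj₂ (a , a∈ , refl) = λ { (¬a ∷ []) (Ka ∷ []) → here (dec-true (gap? J a) (a∈ , Ka , ¬a)) }

      erase-model : ∀ {J'} → ModelRed Π (withGaps J) J' → ModelRed T J (erase J')
      erase-model mJ' = tabulate λ r∈ → admissible-transfer (All.lookup T-admissible r∈) (erase-nonGap _)
                                          (All.lookup mJ' (∈-++⁺ˡ r∈))

      -- a gap atom of withGaps J missing from J' forces Ka to be missing from J'
      erase-below : ∀ {J'} → J' ⊂ withGaps J → ModelRed Π (withGaps J) J' → erase J' ⊂ J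
      erase-below {J'} (J'⊆ , (w , Jw , J'w)) mJ' = below , strict w Jw J'w
        where
          below : ∀ x → erase J' x ≡ true → J x ≡ true
          below (base a)  e = J'⊆ (base a) e
          below (K a)     e = J'⊆ (K a) e
          below (lam k i) e = J'⊆ (lam k i) e
          below (gap _)   ()
          strict : ∀ w → withGaps J w ≡ true → J' w ≡ false → Σ Atom (λ w → J w ≡ true × erase J' w ≡ false)
          strict (base a)  Jw J'w = base a , Jw , J'w
          strict (K a)     Jw J'w = K a , Jw , J'w
          strict (lam k i) Jw J'w = lam k i , Jw , J'w
          strict (gap a)   Jw J'w with withGaps-gap J Jw | J' (K a) in J'Ka
          ... | _ , Ka , _   | false = K a , Ka , J'Ka
          ... | a∈ , _ , ¬a | true  = ⊥-elim (clash (gapRule-fires mJ' a∈ J'Ka ¬a) J'w)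

  gapAtomsBelow⇒gapSub : ∀ {N M} → AnswerSet Π N → AnswerSet Π M → GapAtomsBelow L N M → GapSub N M
  gapAtomsBelow⇒gapSub {N} {M} asN asM (below , (w , w∈ , Mw , Nw)) =
    (λ a g → gapAtom-inGap asM (Mgap a (gap-in-atoms asN g) g)) ,
    (w , gapAtom-inGap asM Mw , λ g → clash (inGap-gapAtom (proj₁ asN) w∈ g) Nw)
    where
      Mgap : ∀ a → a ∈ L → InGap N a → M (gap a) ≡ true
      Mgap a a∈ g = ¬-not λ Mf → clash (inGap-gapAtom (proj₁ asN) a∈ g) (below a a∈ Mf)

  gapSub⇒gapAtomsBelow : ∀ {N M} → AnswerSet Π N → AnswerSet Π M → GapSub N M → GapAtomsBelow L N M
  gapSub⇒gapAtomsBelow asN asM (sub , (w , gM , ¬gN)) =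
    (λ a a∈ Mf → ¬-not λ Nt → clash (inGap-gapAtom (proj₁ asM) a∈ (sub a (gapAtom-inGap asN Nt))) Mf) ,
    (w , w∈ , inGap-gapAtom (proj₁ asM) w∈ gM , ¬-not (¬gN ∘ gapAtom-inGap asN))
    where
      w∈ = gap-in-atoms asM gM

  solution-refutes : (∀ a → a ∈ L → a ∈ Sig) → ∀ {M} → AnswerSet Π M →
    Σ (Interp Atom) (AnswerSet (Π ++ PiM P M)) → ¬ Paracoherent χ Sig P M
  solution-refutes L⊆Sig {M} asM (N , asΠ∪ΠM) (S , _ , agree , minimal)
    with answerSet-split Π (PiM P M) (PiM-constraints P M) asΠ∪ΠM
  ... | asN , satΠM with gapAtomsBelow⇒gapSub asN asM (PiM-sound P satΠM)
  ... | sub , (w , gM , ¬gN) =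
    minimal (erase N , erase-answerSet asN , (λ a → M⇒S a ∘ sub a) , (w , M⇒S w gM , ¬gN))
    where
      -- S agrees with M on Σ ⊇ L, which contains every gap of M
      M⇒S : ∀ a → InGap M a → InGap S a
      M⇒S a (Ka , ¬a) with agree a (L⊆Sig a (gap-in-atoms asM (Ka , ¬a)))
      ... | S≡Ma , S≡MKa = trans S≡MKa Ka , trans S≡Ma ¬a

  -- if Π ∪ Π_M has no answer set, M restricted to Σ^κ is paracoherent: an
  -- answer set of P^χ with fewer gaps would yield one of Π ∪ Π_M
  no-solution-paracoherent : ∀ {M} → AnswerSet Π M →
    ¬ Σ (Interp Atom) (AnswerSet (Π ++ PiM P M)) → Paracoherent χ Sig P M
  no-solution-paracoherent {M} asM none =
    erase M , erase-answerSet asM , (λ _ _ → refl , refl) ,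
    λ { (J , asJ , J<M) → none (withGaps J , answerSet-join Π (PiM P M) (withGaps-answerSet asJ)
          (PiM-complete P (gapSub⇒gapAtomsBelow (withGaps-answerSet asJ) asM J<M))) }

theorem1 : (Sig : List ℕ) (P : Program ℕ) → (∀ a → a ∈ atoms P → a ∈ Sig) →
    (χ : Chi) (M : Interp Atom) → AnswerSet (PiProg χ Sig P) M →
    (Σ (Interp Atom) (λ N → AnswerSet (PiProg χ Sig P ++ PiM P M) N))
      ⇔ (¬ Paracoherent χ Sig P M)
theorem1 Sig P atoms⊆Sig χ M asM =
  mk⇔ (solution-refutes atoms⊆Sig asM)
      (λ ¬para → decidable-stable (existsAnswerSet? (Π ++ PiM P M)) (¬para ∘ no-solution-paracoherent asM))
  where open Correspondence Sig P χ
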